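{- Let $a<b$ be coprime positive integers. For every $(a,b)$-Dyck path $D$, the set partition $\mu(D)$ of $[a+b-1]$ is noncrossing, and the map $D\mapsto\mu(D)$ is injective. Consequently there are exactly $\frac{(a+b-1)!}{a!\,b!}$ homogeneous $(a,b)$-noncrossing partitions.
   Context: An $(a,b)$-Dyck path is a lattice path from $(0,0)$ to $(b,a)$ with unit north and east steps that stays above the line $y=\frac{a}{b}x$ (meeting it only at its endpoints). For such a path $D$ and a lattice point $P\neq(0,0)$ of $D$ which is the bottom of a north step, the laser $\ell(P)$ is the segment of slope $a/b$ from $P$ going northeast up to the first point beyond $P$ where it meets $D$. Label the $a+b-1$ lattice points of $D$ other than its two endpoints by $1,2,\dots,a+b-1$ from southwest to northeast, each label being placed just below its lattice point. Firing all lasers $\ell(P)$ (for all such $P$) cuts the region between $D$ and the line $y=\frac{a}{b}x$ into connected components; $\mu(D)$ is the set partition of $[a+b-1]$ in which $i$ and $j$ are in the same block iff their labels lie in the same component. The partitions $\mu(D)$ are called homogeneous $(a,b)$-noncrossing partitions. A set partition of $[n]$ is noncrossing if there are no $p<q<r<s$ with $p,r$ in one block and $q,s$ in a different block. -}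

module Defs where

open import Data.Nat as ℕ using (ℕ; zero; suc; _+_; _*_; _∸_; _<_; _≤_; _≡ᵇ_)
open import Data.Integer as ℤ using (ℤ; +_; _-_)
open import Data.Bool using (Bool; true; false; if_then_else_)
open import Data.List using (List; []; _∷_; take; filterᵇ; upTo; applyUpTo)
open import Data.Bool using (_∧_)
open import Data.Vec using (Vec; tabulate; lookup)
open import Data.Fin as Fin using (Fin; toℕ)
open import Data.Product using (Σ; _×_)
open import Relation.Nullary using (does)
open import Relation.Binary.PropositionalEquality using (_≡_)

data Step : Set where
  N E : Step

northCount : List Step → ℕ
northCount []      = 0
northCount (N ∷ s) = suc (northCount s)
northCount (E ∷ s) = northCount s

eastCount : List Step → ℕ
eastCount []      = 0
eastCount (E ∷ s) = suc (eastCount s)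
eastCount (N ∷ s) = eastCount s

-- The t-th lattice point p_t = (xc D t , yc D t) of D  (p_0 = (0,0)).
xc : List Step → ℕ → ℕ
xc D t = eastCount (take t D)

yc : List Step → ℕ → ℕ
yc D t = northCount (take t D)

-- (a,b)-Dyck path: from (0,0) to (b,a) (a north steps, b east steps),
-- every lattice point other than the two endpoints lies strictly above
-- the line y = (a/b) x, i.e.  a*x < b*y.
-- (Then the whole path stays above the line, meeting it only at the
-- endpoints, since consecutive lattice points are joined by segments.)
record IsDyck (a b : ℕ) (D : List Step) : Set where
  field
    north-steps : northCount D ≡ a
    east-steps  : eastCount D ≡ b
    above       : ∀ t → 0 < t → t < a + b → a * xc D t < b * yc D t

-- level of p_t : (b*y - a*x); lines of slope a/b are the level sets,
-- the line y = (a/b)x is level 0.  A laser from p_m runs at level(p_m).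
level : ℕ → ℕ → List Step → ℕ → ℤ
level a b D t = + (b * yc D t) - + (a * xc D t)

allᵇ : {A : Set} → (A → Bool) → List A → Bool
allᵇ p []       = true
allᵇ p (x ∷ xs) = p x ∧ allᵇ p xs

-- [m+1 .. i]
interval : ℕ → ℕ → List ℕ
interval m i = applyUpTo (λ k → suc m + k) (i ∸ m)

-- The laser ℓ(p_m) fired from p_m (or, for m = 0, the base line
-- y = (a/b)x) passes directly beneath the lattice point p_i
-- (i.e. crosses the perpendicular from p_i to the base line below p_i):
-- m < i and the path D stays strictly above level(p_m) at all lattice
-- points p_{m+1}, ..., p_i (so the laser has not yet hit D).
passesBeneathᵇ : ℕ → ℕ → List Step → ℕ → ℕ → Bool
passesBeneathᵇ a b D m i =
  allᵇ (λ t → does (level a b D m ℤ.<? level a b D t)) (interval m i)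

highest : (ℕ → ℤ) → ℕ → List ℕ → ℕ
highest lv best []       = best
highest lv best (m ∷ ms) =
  highest lv (if does (lv best ℤ.<? lv m) then m else best) ms

-- The floor of label i (placed just below p_i): the laser (identified by
-- its starting index m ≥ 1), or the base line (m = 0), that lies
-- immediately below label i.  The connected component of the region
-- (between D and y=(a/b)x, cut by all lasers) containing label i is the
-- one sitting directly on top of this laser / base line.
floorOf : ℕ → ℕ → List Step → ℕ → ℕ
floorOf a b D i =
  highest (level a b D) 0 (filterᵇ (λ m → passesBeneathᵇ a b D m i) (upTo i))

-- Set partitions of [n] = {1..n} are represented by their (Boolean)
-- "same block" matrix; index k : Fin n stands for the element k+1.
Partition : ℕ → Set
Partition n = Vec (Vec Bool n) n

SameBlock : ∀ {n} → Partition n → Fin n → Fin n → Set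
SameBlock M i j = lookup (lookup M i) j ≡ true

-- μ(D) as a set partition of [a+b-1]: labels i, j (lattice points p_i,
-- p_j, 1 ≤ i,j ≤ a+b-1) are in the same block iff they lie in the same
-- connected component, i.e. iff they have the same floor.
μ : (a b : ℕ) → List Step → Partition (a + b ∸ 1)
μ a b D = tabulate λ i → tabulate λ j →
  floorOf a b D (suc (toℕ i)) ≡ᵇ floorOf a b D (suc (toℕ j))

NonCrossing : ∀ {n} → Partition n → Set
NonCrossing {n} M = (p q r s : Fin n) → p Fin.< q → q Fin.< r → r Fin.< s →
  SameBlock M p r → SameBlock M q s → SameBlock M p q

HomogeneousNC : (a b : ℕ) → Partition (a + b ∸ 1) → Set
HomogeneousNC a b M = Σ (List Step) λ D → IsDyck a b D × μ a b D ≡ M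

-- Give the lattice point p_t of a path the level b·y − a·x, so that the line y = (a/b)x is level 0 and
-- the laser fired from p_m runs at level(p_m).  The region containing label i sits on the laser fired
-- from the floor of i, the last earlier point strictly below p_i.  If two labels have the same floor,
-- every point between them is at least as high as the later one; this rules out crossings.  Moreover
-- label t+1 is the least label of its block exactly when step t is an ascent, i.e. a north step, and
-- the last step is always east, so μ(D) determines D.
--
-- For the count, coprimality makes the prefix levels 0, …, a+b−1 of any word with a north and b east
-- steps pairwise distinct: a factor of level 0 would be a lattice point (x, y) ≠ 0 on the line with
-- x + y < a + b.  Rotating the word to start at its lowest prefix gives a Dyck path, and no
-- nontrivial rotation of a Dyck path is a Dyck path (the cycle lemma).  Hence the (a+b)!/(a!b!)
-- words correspond to pairs of a Dyck path and a rotation amount below a+b.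

module Submission where

open import Defs
open import Data.Nat using (ℕ; _+_; _*_; _∸_; _<_; _!; _/_)
open import Data.Nat.Properties using (_!*_!≢0)
open import Data.Nat.Coprimality using (Coprime)
open import Data.List using (List; length)
open import Data.List.Membership.Propositional using (_∈_)
open import Data.List.Relation.Unary.Unique.Propositional using (Unique)
open import Data.Product using (Σ; _×_)
open import Function.Bundles using (_⇔_)
open import Relation.Binary.PropositionalEquality using (_≡_)

open import Algebra.Bundles using (AbelianGroup)
open import Data.Bool using (Bool; T; _∧_)
open import Data.Bool.ListAction using (all)
open import Data.Bool.Properties using (T-≡)
open import Data.Empty using (⊥)
open import Data.Fin using (Fin; toℕ; fromℕ<)
open import Data.Fin.Properties using (toℕ<n; toℕ-fromℕ<)
open import Data.Integer as ℤ using (ℤ; +_; -_; _-_; 0ℤ)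
import Data.Integer.Properties as ℤ
open import Data.Integer.Tactic.RingSolver using (solve-∀)
open import Data.List using ([]; _∷_; [_]; _++_; take; drop; map; filter; filterᵇ; upTo; cartesianProduct)
open import Data.List.Extrema ℤ.≤-totalOrder using (argmin; argmin-all; f[argmin]≤f[xs])
open import Data.List.Membership.Propositional.Properties
  using (∈-∃++; ∈-map⁺; ∈-map⁻; ∈-++⁺ˡ; ∈-++⁺ʳ; ∈-++⁻; ∈-cartesianProduct⁺; ∈-cartesianProduct⁻;
         ∈-applyUpTo⁺; ∈-applyUpTo⁻; ∈-upTo⁺; ∈-upTo⁻; ∈-filter⁺; ∈-filter⁻)
open import Data.List.Properties
  using (∷-injectiveʳ; length-++; length-++-sucʳ; length-map; length-upTo; length-take; length-drop;
         take-[]; take-all; take-take; drop-all; drop-drop; take++drop≡id; ++-identityʳ; ++-assoc)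
open import Data.List.Relation.Binary.Subset.Propositional using (_⊆_)
open import Data.List.Relation.Unary.All as All using (All; _∷_)
open import Data.List.Relation.Unary.All.Properties as All using (all⁺; all⁻)
open import Data.List.Relation.Unary.AllPairs as AllPairs using (_∷_)
open import Data.List.Relation.Unary.Any using (here; there)
import Data.List.Relation.Unary.Unique.Propositional.Properties as Unique
open import Data.Nat using (zero; suc; _≤_; z≤n; s≤s; _≡ᵇ_; NonZero)
import Data.Nat.Coprimality as Coprime
open import Data.Nat.Divisibility using (divides; ∣⇒≤)
open import Data.Nat.DivMod using (m*n/n≡m)
import Data.Nat.Properties as ℕ
open import Data.Nat.Solver using (module +-*-Solver)
open import Data.Product using (_,_; proj₁; proj₂; ∃; ∃-syntax)
open import Data.Sum as Sum using (_⊎_; inj₁; inj₂)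
open import Data.Vec using (lookup)
open import Data.Vec.Properties using (lookup∘tabulate)
open import Function using (case_of_; _∘_)
open import Function.Bundles using (mk⇔; Equivalence)
import Function.Properties.Equivalence as ⇔
open import Relation.Binary using (Tri; tri<; tri≈; tri>)
open import Relation.Binary.PropositionalEquality
  using (refl; sym; trans; cong; cong₂; subst; subst₂; _≢_; module ≡-Reasoning)
open import Relation.Nullary using (¬_; yes; no; contradiction)
open import Relation.Nullary.Decidable using (Dec; does; T?; map′; _×-dec_; _→-dec_)
open import Relation.Unary using (Decidable)

open import Algebra.Properties.Group (AbelianGroup.group ℤ.+-0-abelianGroup) using (identityʳ-unique)

private
  variable
    A : Set
    m i k t : ℕ

0<i-j⇒j<i : ∀ {i j} → 0ℤ ℤ.< i - j → j ℤ.< i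
0<i-j⇒j<i {i} {j} 0<i-j with j ℤ.<? i
... | yes j<i = j<i
... | no  j≮i = contradiction (ℤ.i≤j⇒i-j≤0 (ℤ.≮⇒≥ j≮i)) (ℤ.<⇒≱ 0<i-j)

j<i⇒0<i-j : ∀ {i j} → j ℤ.< i → 0ℤ ℤ.< i - j
j<i⇒0<i-j {i} {j} j<i = subst (ℤ._< i - j) (ℤ.+-inverseʳ j) (ℤ.+-monoˡ-< (- j) j<i)

i+j≡k∧j<k⇒0<i : ∀ {i j k} → i ℤ.+ j ≡ k → j ℤ.< k → 0ℤ ℤ.< i
i+j≡k∧j<k⇒0<i {i} {j} refl j<k = subst (0ℤ ℤ.<_) (cancel i j) (j<i⇒0<i-j j<k)
  where
  cancel : ∀ i j → (i ℤ.+ j) - j ≡ i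
  cancel = solve-∀

suc<⇒<∸1 : ∀ {x n} → suc x < n → x < n ∸ 1
suc<⇒<∸1 {n = suc n} (s≤s x<n) = x<n

<∸1⇒suc< : ∀ {x n} → x < n ∸ 1 → suc x < n
<∸1⇒suc< {n = suc n} x<n = s≤s x<n

wrap-offset : ∀ {m n t} → m ≤ n → n ≤ m + t → n ∸ m + (m + t ∸ n) ≡ t
wrap-offset {m} {n} {t} m≤n n≤m+t = ℕ.+-cancelˡ-≡ m _ t (begin
  m + (n ∸ m + (m + t ∸ n))   ≡⟨ ℕ.+-assoc m (n ∸ m) _ ⟨
  m + (n ∸ m) + (m + t ∸ n)   ≡⟨ cong (_+ (m + t ∸ n)) (ℕ.m+[n∸m]≡n m≤n) ⟩
  n + (m + t ∸ n)             ≡⟨ ℕ.m+[n∸m]≡n n≤m+t ⟩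
  m + t                       ∎)
  where open ≡-Reasoning

m*n*o≡n!⇒m*o≡[n∸1]! : ∀ m n o → 0 < n → m * n * o ≡ n ! → m * o ≡ (n ∸ 1) !
m*n*o≡n!⇒m*o≡[n∸1]! m (suc n) o _ eq =
  ℕ.*-cancelˡ-≡ (m * o) (n !) (suc n) (trans (rearrange m (suc n) o) eq)
  where
  open +-*-Solver
  rearrange : ∀ m n o → n * (m * o) ≡ m * n * o
  rearrange = solve 3 (λ m n o → n :* (m :* o) := m :* n :* o) refl

coprime-lattice-bound : ∀ {a b x y} → 0 < a → 0 < b → Coprime a b →
  b * y ≡ a * x → 0 < y + x → a + b ≤ y + x
coprime-lattice-bound {a} {b} {zero}  {zero}  _   _   _   _   ()
coprime-lattice-bound {a} {b} {zero}  {suc y} _ (s≤s z≤n) _ by≡ax _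
  with () ← trans by≡ax (ℕ.*-zeroʳ a)
coprime-lattice-bound {a} {b} {suc x} {zero}  (s≤s z≤n) _ _ by≡ax _
  with () ← trans (sym by≡ax) (ℕ.*-zeroʳ b)
coprime-lattice-bound {a} {b} {suc x} {suc y} _   _   cop by≡ax _ = ℕ.+-mono-≤ a≤y b≤x
  where
  a≤y : a ≤ suc y
  a≤y = ∣⇒≤ (Coprime.coprime-divisor cop (divides (suc x) (trans by≡ax (ℕ.*-comm a (suc x)))))
  b≤x : b ≤ suc x
  b≤x = ∣⇒≤ (Coprime.coprime-divisor (Coprime.sym cop)
                (divides (suc y) (trans (sym by≡ax) (ℕ.*-comm b (suc y)))))

-- Lists and rotations

take-+ : ∀ s d (w : List A) → take (s + d) w ≡ take s w ++ take d (drop s w)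
take-+ zero    d w       = refl
take-+ (suc s) d []      = sym (take-[] d)
take-+ (suc s) d (x ∷ w) = cong (x ∷_) (take-+ s d w)

take-++ˡ : ∀ (X Y : List A) → t ≤ length X → take t (X ++ Y) ≡ take t X
take-++ˡ {t = zero}  X       Y _          = refl
take-++ˡ {t = suc t} (x ∷ X) Y (s≤s t≤∣X∣) = cong (x ∷_) (take-++ˡ X Y t≤∣X∣)

take-++ʳ : ∀ u (X Y : List A) → take (length X + u) (X ++ Y) ≡ X ++ take u Y
take-++ʳ u []      Y = refl
take-++ʳ u (x ∷ X) Y = cong (x ∷_) (take-++ʳ u X Y)

drop-++ˡ : ∀ (X Y : List A) {k} → k ≤ length X → drop k (X ++ Y) ≡ drop k X ++ Y
drop-++ˡ X       Y {zero}  _          = refl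
drop-++ˡ (x ∷ X) Y {suc k} (s≤s k≤∣X∣) = drop-++ˡ X Y k≤∣X∣

Unique⇒length≤ : ∀ {xs ys : List A} → Unique xs → xs ⊆ ys → length xs ≤ length ys
Unique⇒length≤ {xs = []}     _              _     = z≤n
Unique⇒length≤ {xs = x ∷ xs} (x∉xs ∷ unique) xs⊆ys
  with ys₁ , ys₂ , refl ← ∈-∃++ (xs⊆ys (here refl)) =
  subst (suc (length xs) ≤_) (sym (length-++-sucʳ ys₁ x ys₂)) (s≤s (Unique⇒length≤ unique remove-x))
  where
  remove-x : xs ⊆ ys₁ ++ ys₂
  remove-x {y} y∈xs with ∈-++⁻ ys₁ (xs⊆ys (there y∈xs))
  ... | inj₁ y∈ys₁          = ∈-++⁺ˡ y∈ys₁
  ... | inj₂ (here refl)    = contradiction refl (All.lookup x∉xs y∈xs)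
  ... | inj₂ (there y∈ys₂)  = ∈-++⁺ʳ ys₁ y∈ys₂

Unique-map⁺ : ∀ {B : Set} (f : A → B) {xs} → (∀ {x y} → x ∈ xs → y ∈ xs → f x ≡ f y → x ≡ y) →
              Unique xs → Unique (map f xs)
Unique-map⁺ f {[]}     _         _                = AllPairs.[]
Unique-map⁺ f {x ∷ xs} injective (x∉xs ∷ unique) =
  All.map⁺ (All.tabulate λ y∈ fx≡fy → All.lookup x∉xs y∈ (injective (here refl) (there y∈) fx≡fy))
    ∷ Unique-map⁺ f (λ x∈ y∈ → injective (there x∈) (there y∈)) unique

length-cartesianProduct : ∀ {B : Set} (xs : List A) (ys : List B) →
                          length (cartesianProduct xs ys) ≡ length xs * length ys
length-cartesianProduct []       ys = refl
length-cartesianProduct (x ∷ xs) ys = trans (length-++ (map (x ,_) ys))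
  (cong₂ _+_ (length-map (x ,_) ys) (length-cartesianProduct xs ys))

rotate : ℕ → List A → List A
rotate k w = drop k w ++ take k w

rotate-zero : ∀ (w : List A) → rotate 0 w ≡ w
rotate-zero = ++-identityʳ

rotate-length : ∀ (w : List A) → rotate (length w) w ≡ w
rotate-length w rewrite drop-all (length w) w ℕ.≤-refl = take-all (length w) w ℕ.≤-refl

rotate-additive : ∀ (f : List A → ℕ) → (∀ X Y → f (X ++ Y) ≡ f X + f Y) →
                  ∀ k w → f (rotate k w) ≡ f w
rotate-additive f f-++ k w = begin
  f (drop k w ++ take k w)   ≡⟨ f-++ (drop k w) (take k w) ⟩
  f (drop k w) + f (take k w) ≡⟨ ℕ.+-comm (f (drop k w)) _ ⟩
  f (take k w) + f (drop k w) ≡⟨ f-++ (take k w) (drop k w) ⟨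
  f (take k w ++ drop k w)   ≡⟨ cong f (take++drop≡id k w) ⟩
  f w                        ∎
  where open ≡-Reasoning

length-rotate : ∀ k (w : List A) → length (rotate k w) ≡ length w
length-rotate = rotate-additive length (λ X Y → length-++ X)

rotate-rotate : ∀ i j (w : List A) → i + j ≤ length w → rotate i (rotate j w) ≡ rotate (i + j) w
rotate-rotate i j w i+j≤∣w∣ = begin
  drop i (drop j w ++ take j w) ++ take i (drop j w ++ take j w)
    ≡⟨ cong₂ _++_ (drop-++ˡ (drop j w) (take j w) i≤) (take-++ˡ (drop j w) (take j w) i≤) ⟩
  (drop i (drop j w) ++ take j w) ++ take i (drop j w)
    ≡⟨ ++-assoc (drop i (drop j w)) (take j w) (take i (drop j w)) ⟩
  drop i (drop j w) ++ (take j w ++ take i (drop j w))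
    ≡⟨ cong₂ _++_ (trans (drop-drop j i w) (cong (λ k → drop k w) (ℕ.+-comm j i)))
                  (trans (sym (take-+ j i w)) (cong (λ k → take k w) (ℕ.+-comm j i))) ⟩
  rotate (i + j) w ∎
  where
  open ≡-Reasoning
  i≤ : i ≤ length (drop j w)
  i≤ = subst (i ≤_) (sym (length-drop j w)) (ℕ.m+n≤o⇒m≤o∸n i i+j≤∣w∣)

rotate-rotate-wrap : ∀ i j (w : List A) → i ≤ length w → j ≤ length w → length w ≤ i + j →
                     rotate i (rotate j w) ≡ rotate (i + j ∸ length w) w
rotate-rotate-wrap i j w i≤n j≤n n≤i+j = begin
  rotate i (rotate j w)                  ≡⟨ cong (λ k → rotate k (rotate j w)) i≡r+[n∸j] ⟩
  rotate (r + (n ∸ j)) (rotate j w)      ≡⟨ rotate-rotate r (n ∸ j) (rotate j w) r+[n∸j]≤ ⟨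
  rotate r (rotate (n ∸ j) (rotate j w)) ≡⟨ cong (rotate r) full-turn ⟩
  rotate r w                             ∎
  where
  open ≡-Reasoning
  n r : ℕ
  n = length w
  r = i + j ∸ n
  i≡r+[n∸j] : i ≡ r + (n ∸ j)
  i≡r+[n∸j] = ℕ.+-cancelʳ-≡ j i (r + (n ∸ j)) (begin
    i + j               ≡⟨ ℕ.m∸n+n≡m n≤i+j ⟨
    r + n               ≡⟨ cong (_+_ r) (ℕ.m∸n+n≡m j≤n) ⟨
    r + (n ∸ j + j)     ≡⟨ ℕ.+-assoc r (n ∸ j) j ⟨
    r + (n ∸ j) + j     ∎)
  r+[n∸j]≤ : r + (n ∸ j) ≤ length (rotate j w)
  r+[n∸j]≤ = subst₂ _≤_ i≡r+[n∸j] (sym (length-rotate j w)) i≤n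
  full-turn : rotate (n ∸ j) (rotate j w) ≡ w
  full-turn = begin
    rotate (n ∸ j) (rotate j w) ≡⟨ rotate-rotate (n ∸ j) j w (ℕ.≤-reflexive (ℕ.m∸n+n≡m j≤n)) ⟩
    rotate (n ∸ j + j) w        ≡⟨ cong (λ k → rotate k w) (ℕ.m∸n+n≡m j≤n) ⟩
    rotate n w                  ≡⟨ rotate-length w ⟩
    w                           ∎

rotate-rotate-cyclic : ∀ i j (w : List A) → i < length w → j < length w →
  ∃[ s ] s < length w × rotate i (rotate j w) ≡ rotate s w × (i + j ≡ s ⊎ i + j ≡ length w + s)
rotate-rotate-cyclic i j w i<n j<n with i + j ℕ.<? length w
... | yes i+j<n = i + j , i+j<n , rotate-rotate i j w (ℕ.<⇒≤ i+j<n) , inj₁ refl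
... | no  i+j≮n = i + j ∸ length w , s<n
                , rotate-rotate-wrap i j w (ℕ.<⇒≤ i<n) (ℕ.<⇒≤ j<n) n≤i+j
                , inj₂ (sym (ℕ.m+[n∸m]≡n n≤i+j))
  where
  n≤i+j : length w ≤ i + j
  n≤i+j = ℕ.≮⇒≥ i+j≮n
  s<n : i + j ∸ length w < length w
  s<n = subst (i + j ∸ length w <_) (ℕ.m+n∸n≡m (length w) (length w))
          (ℕ.∸-monoˡ-< (ℕ.+-mono-< i<n j<n) n≤i+j)

unrotation : ℕ → ℕ → ℕ
unrotation n zero    = zero
unrotation n (suc m) = n ∸ suc m

unrotation< : ∀ {n m} → m < n → unrotation n m < n
unrotation< {n} {zero}  0<n = 0<n
unrotation< {n} {suc m} m<n = ℕ.∸-monoʳ-< (s≤s z≤n) (ℕ.<⇒≤ m<n)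

rotate-unrotate : ∀ m (w : List A) → m ≤ length w → rotate (unrotation (length w) m) (rotate m w) ≡ w
rotate-unrotate zero    w _      = trans (rotate-zero (rotate 0 w)) (rotate-zero w)
rotate-unrotate (suc m) w m+1≤n = begin
  rotate (length w ∸ suc m) (rotate (suc m) w) ≡⟨ rotate-rotate _ (suc m) w (ℕ.≤-reflexive full) ⟩
  rotate (length w ∸ suc m + suc m) w         ≡⟨ cong (λ k → rotate k w) full ⟩
  rotate (length w) w                         ≡⟨ rotate-length w ⟩
  w                                           ∎
  where
  open ≡-Reasoning
  full : length w ∸ suc m + suc m ≡ length w
  full = ℕ.m∸n+n≡m m+1≤n

unrotation-complement : ∀ {n i j} → j < n → (i + j ≡ 0 ⊎ i + j ≡ n + 0) → unrotation n i ≡ j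
unrotation-complement {i = zero}  {zero}  _   _          = refl
unrotation-complement {i = zero}  {suc j} j<n (inj₂ j≡n) =
  contradiction (trans j≡n (ℕ.+-identityʳ _)) (ℕ.<⇒≢ j<n)
unrotation-complement {n} {suc i} {j} _ (inj₂ i+j≡n) =
  trans (cong (_∸ suc i) (trans (sym (ℕ.+-identityʳ n)) (sym i+j≡n))) (ℕ.m+n∸m≡n (suc i) j)

-- Lattice paths

northCount-++ : ∀ X Y → northCount (X ++ Y) ≡ northCount X + northCount Y
northCount-++ []      Y = refl
northCount-++ (N ∷ X) Y = cong suc (northCount-++ X Y)
northCount-++ (E ∷ X) Y = northCount-++ X Y

eastCount-++ : ∀ X Y → eastCount (X ++ Y) ≡ eastCount X + eastCount Y
eastCount-++ []      Y = refl
eastCount-++ (N ∷ X) Y = eastCount-++ X Y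
eastCount-++ (E ∷ X) Y = cong suc (eastCount-++ X Y)

length≡northCount+eastCount : ∀ D → length D ≡ northCount D + eastCount D
length≡northCount+eastCount []      = refl
length≡northCount+eastCount (N ∷ D) = cong suc (length≡northCount+eastCount D)
length≡northCount+eastCount (E ∷ D) =
  trans (cong suc (length≡northCount+eastCount D)) (sym (ℕ.+-suc _ _))

-- Junk value E beyond the end of the path.
stepAt : List Step → ℕ → Step
stepAt []      _       = E
stepAt (x ∷ _) zero    = x
stepAt (_ ∷ D) (suc t) = stepAt D t

take-suc-stepAt : ∀ D → t < length D → take (suc t) D ≡ take t D ++ [ stepAt D t ]
take-suc-stepAt {zero}  (x ∷ D) _          = refl
take-suc-stepAt {suc t} (x ∷ D) (s≤s t<∣D∣) = cong (x ∷_) (take-suc-stepAt D t<∣D∣)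

stepAt-extensionality : ∀ D D′ → length D ≡ length D′ →
  (∀ {t} → t < length D → stepAt D t ≡ stepAt D′ t) → D ≡ D′
stepAt-extensionality []      []        _   _    = refl
stepAt-extensionality (x ∷ D) (x′ ∷ D′) ∣D∣≡ same =
  cong₂ _∷_ (same (s≤s z≤n))
            (stepAt-extensionality D D′ (ℕ.suc-injective ∣D∣≡) (λ t< → same (s≤s t<)))

≡N⇔≡N⇒≡ : ∀ {x y} → (x ≡ N ⇔ y ≡ N) → x ≡ y
≡N⇔≡N⇒≡ {N} {N} _   = refl
≡N⇔≡N⇒≡ {E} {E} _   = refl
≡N⇔≡N⇒≡ {N} {E} x⇔y with () ← Equivalence.to x⇔y refl
≡N⇔≡N⇒≡ {E} {N} x⇔y with () ← Equivalence.from x⇔y refl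

record Balanced (a b : ℕ) (w : List Step) : Set where
  constructor balanced
  field
    north-steps : northCount w ≡ a
    east-steps  : eastCount w ≡ b

length-balanced : ∀ {a b w} → Balanced a b w → length w ≡ a + b
length-balanced {w = w} (balanced north east) =
  trans (length≡northCount+eastCount w) (cong₂ _+_ north east)

rotate-balanced : ∀ {a b w} k → Balanced a b w → Balanced a b (rotate k w)
rotate-balanced {w = w} k (balanced north east) = balanced
  (trans (rotate-additive northCount northCount-++ k w) north)
  (trans (rotate-additive eastCount eastCount-++ k w) east)

dyck⇒balanced : ∀ {a b D} → IsDyck a b D → Balanced a b D
dyck⇒balanced d = balanced (IsDyck.north-steps d) (IsDyck.east-steps d)

paths : ℕ → ℕ → List (List Step)
paths zero    zero    = [ [] ]
paths zero    (suc b) = map (E ∷_) (paths zero b)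
paths (suc a) zero    = map (N ∷_) (paths a zero)
paths (suc a) (suc b) = map (N ∷_) (paths a (suc b)) ++ map (E ∷_) (paths (suc a) b)

∈-paths⇔ : ∀ {a b w} → w ∈ paths a b ⇔ Balanced a b w
∈-paths⇔ {a} {b} {w} = mk⇔ (sound a b) λ where (balanced refl refl) → complete w
  where
  cons-N : ∀ {a b w} → Balanced a b w → Balanced (suc a) b (N ∷ w)
  cons-N (balanced north east) = balanced (cong suc north) east
  cons-E : ∀ {a b w} → Balanced a b w → Balanced a (suc b) (E ∷ w)
  cons-E (balanced north east) = balanced north (cong suc east)
  sound : ∀ a b {w} → w ∈ paths a b → Balanced a b w
  sound zero    zero    (here refl) = balanced refl refl
  sound zero    (suc b) w∈ with v , v∈ , refl ← ∈-map⁻ (E ∷_) w∈ = cons-E (sound zero b v∈)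
  sound (suc a) zero    w∈ with v , v∈ , refl ← ∈-map⁻ (N ∷_) w∈ = cons-N (sound a zero v∈)
  sound (suc a) (suc b) w∈ with ∈-++⁻ (map (N ∷_) (paths a (suc b))) w∈
  ... | inj₁ w∈N with v , v∈ , refl ← ∈-map⁻ (N ∷_) w∈N = cons-N (sound a (suc b) v∈)
  ... | inj₂ w∈E with v , v∈ , refl ← ∈-map⁻ (E ∷_) w∈E = cons-E (sound (suc a) b v∈)
  complete : ∀ w → w ∈ paths (northCount w) (eastCount w)
  complete []      = here refl
  complete (N ∷ w) with northCount w | eastCount w | complete w
  ... | _ | zero  | w∈ = ∈-map⁺ (N ∷_) w∈
  ... | _ | suc _ | w∈ = ∈-++⁺ˡ (∈-map⁺ (N ∷_) w∈)
  complete (E ∷ w) with northCount w | eastCount w | complete w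
  ... | zero  | _ | w∈ = ∈-map⁺ (E ∷_) w∈
  ... | suc _ | _ | w∈ = ∈-++⁺ʳ _ (∈-map⁺ (E ∷_) w∈)

paths-unique : ∀ a b → Unique (paths a b)
paths-unique zero    zero    = All.[] ∷ AllPairs.[]
paths-unique zero    (suc b) = Unique.map⁺ ∷-injectiveʳ (paths-unique zero b)
paths-unique (suc a) zero    = Unique.map⁺ ∷-injectiveʳ (paths-unique a zero)
paths-unique (suc a) (suc b) = Unique.++⁺ (Unique.map⁺ ∷-injectiveʳ (paths-unique a (suc b)))
                                          (Unique.map⁺ ∷-injectiveʳ (paths-unique (suc a) b)) disjoint
  where
  disjoint : ∀ {v} → v ∈ map (N ∷_) (paths a (suc b)) × v ∈ map (E ∷_) (paths (suc a) b) → ⊥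
  disjoint (v∈N , v∈E) with _ , _ , refl ← ∈-map⁻ (N ∷_) v∈N with _ , _ , () ← ∈-map⁻ (E ∷_) v∈E

length-paths-zeroˡ : ∀ b → length (paths zero b) ≡ 1
length-paths-zeroˡ zero    = refl
length-paths-zeroˡ (suc b) = trans (length-map (E ∷_) (paths zero b)) (length-paths-zeroˡ b)

length-paths-zeroʳ : ∀ a → length (paths a zero) ≡ 1
length-paths-zeroʳ zero    = refl
length-paths-zeroʳ (suc a) = trans (length-map (N ∷_) (paths a zero)) (length-paths-zeroʳ a)

length-paths : ∀ a b → length (paths a b) * (a ! * b !) ≡ (a + b) !
length-paths zero b = trans (cong (_* (1 * b !)) (length-paths-zeroˡ b))
                            (trans (ℕ.*-identityˡ (1 * b !)) (ℕ.*-identityˡ (b !)))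
length-paths (suc a) zero = begin
  length (paths (suc a) zero) * (suc a ! * 1) ≡⟨ cong (_* (suc a ! * 1)) (length-paths-zeroʳ (suc a)) ⟩
  1 * (suc a ! * 1)                           ≡⟨ trans (ℕ.*-identityˡ _) (ℕ.*-identityʳ _) ⟩
  suc a !                                     ≡⟨ cong _! (ℕ.+-identityʳ (suc a)) ⟨
  (suc a + 0) !                               ∎
  where open ≡-Reasoning
length-paths (suc a) (suc b) = begin
  length (map (N ∷_) (paths a (suc b)) ++ map (E ∷_) (paths (suc a) b)) * (suc a ! * suc b !)
    ≡⟨ cong (_* (suc a ! * suc b !))
            (trans (length-++ (map (N ∷_) (paths a (suc b))))
                   (cong₂ _+_ (length-map _ (paths a (suc b))) (length-map _ (paths (suc a) b)))) ⟩
  (ℓN + ℓE) * ((suc a * a !) * (suc b * b !))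
    ≡⟨ solve 6 (λ ℓN ℓE sa A sb B → (ℓN :+ ℓE) :* ((sa :* A) :* (sb :* B))
                                 := (ℓN :* (A :* (sb :* B))) :* sa :+ (ℓE :* ((sa :* A) :* B)) :* sb)
               refl ℓN ℓE (suc a) (a !) (suc b) (b !) ⟩
  (ℓN * (a ! * suc b !)) * suc a + (ℓE * (suc a ! * b !)) * suc b
    ≡⟨ cong₂ (λ x y → x * suc a + y * suc b) (length-paths a (suc b)) (length-paths (suc a) b) ⟩
  (a + suc b) ! * suc a + (suc a + b) ! * suc b
    ≡⟨ cong (λ k → (a + suc b) ! * suc a + k ! * suc b) (ℕ.+-suc a b) ⟨
  (a + suc b) ! * suc a + (a + suc b) ! * suc b
    ≡⟨ ℕ.*-distribˡ-+ ((a + suc b) !) (suc a) (suc b) ⟨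
  (a + suc b) ! * (suc a + suc b)
    ≡⟨ ℕ.*-comm ((a + suc b) !) (suc a + suc b) ⟩
  (suc a + suc b) * (a + suc b) ! ∎
  where
  open ≡-Reasoning
  open +-*-Solver
  ℓN ℓE : ℕ
  ℓN = length (paths a (suc b))
  ℓE = length (paths (suc a) b)

isDyck? : ∀ a b D → Dec (IsDyck a b D)
isDyck? a b D = map′
  (λ ((north , east) , above) → record
    { north-steps = north ; east-steps = east ; above = λ t 0<t t<n → above t<n 0<t })
  (λ d → (IsDyck.north-steps d , IsDyck.east-steps d) , λ {t} t<n 0<t → IsDyck.above d t 0<t t<n)
  ((northCount D ℕ.≟ a ×-dec eastCount D ℕ.≟ b) ×-dec
   ℕ.allUpTo? (λ t → 0 ℕ.<? t →-dec a * xc D t ℕ.<? b * yc D t) (a + b))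

dyckPaths : ℕ → ℕ → List (List Step)
dyckPaths a b = filter (isDyck? a b) (paths a b)

∈-dyckPaths⇔ : ∀ {a b D} → D ∈ dyckPaths a b ⇔ IsDyck a b D
∈-dyckPaths⇔ {a} {b} {D} = mk⇔ (λ D∈ → proj₂ (∈-filter⁻ (isDyck? a b) {xs = paths a b} D∈))
  λ d → ∈-filter⁺ (isDyck? a b) (Equivalence.from ∈-paths⇔ (dyck⇒balanced d)) d

dyckPaths-unique : ∀ a b → Unique (dyckPaths a b)
dyckPaths-unique a b = Unique.filter⁺ (isDyck? a b) (paths-unique a b)

-- Levels

module Levels (a b : ℕ) where

  weight : List Step → ℤ
  weight v = + (b * northCount v) - + (a * eastCount v)

  weight-++ : ∀ X Y → weight (X ++ Y) ≡ weight X ℤ.+ weight Y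
  weight-++ X Y = begin
    + (b * northCount (X ++ Y)) - + (a * eastCount (X ++ Y))
      ≡⟨ cong₂ (λ p q → + p - + q) (scaled-++ b northCount northCount-++)
                                    (scaled-++ a eastCount eastCount-++) ⟩
    + (b * northCount X + b * northCount Y) - + (a * eastCount X + a * eastCount Y)
      ≡⟨ regroup (+ (b * northCount X)) (+ (b * northCount Y))
                 (+ (a * eastCount X)) (+ (a * eastCount Y)) ⟩
    weight X ℤ.+ weight Y ∎
    where
    open ≡-Reasoning
    scaled-++ : ∀ c (f : List Step → ℕ) → (∀ X Y → f (X ++ Y) ≡ f X + f Y) →
                c * f (X ++ Y) ≡ c * f X + c * f Y
    scaled-++ c f f-++ = trans (cong (c *_) (f-++ X Y)) (ℕ.*-distribˡ-+ c (f X) (f Y))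
    regroup : ∀ (p q r s : ℤ) → (p ℤ.+ q) - (r ℤ.+ s) ≡ (p - r) ℤ.+ (q - s)
    regroup = solve-∀

  weight-[] : weight [] ≡ 0ℤ
  weight-[] rewrite ℕ.*-zeroʳ b | ℕ.*-zeroʳ a = refl

  weight-N : weight [ N ] ≡ + b
  weight-N rewrite ℕ.*-identityʳ b | ℕ.*-zeroʳ a = ℤ.+-identityʳ (+ b)

  weight-E : weight [ E ] ≡ - + a
  weight-E rewrite ℕ.*-identityʳ a | ℕ.*-zeroʳ b = ℤ.+-identityˡ (- + a)

  0<weight⇔ : ∀ v → 0ℤ ℤ.< weight v ⇔ a * eastCount v < b * northCount v
  0<weight⇔ v = mk⇔ (λ 0<w → ℤ.drop‿+<+ (0<i-j⇒j<i 0<w)) (λ x<y → j<i⇒0<i-j (ℤ.+<+ x<y))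

  weight≡0⇒ : ∀ v → weight v ≡ 0ℤ → b * northCount v ≡ a * eastCount v
  weight≡0⇒ v w≡0 = ℤ.+-injective (ℤ.i-j≡0⇒i≡j _ _ w≡0)

  weight-balanced : ∀ {v} → Balanced a b v → weight v ≡ 0ℤ
  weight-balanced (balanced refl refl) rewrite ℕ.*-comm b a = ℤ.+-inverseʳ (+ (a * b))

  level-suc : ∀ D → t < length D → level a b D (suc t) ≡ level a b D t ℤ.+ weight [ stepAt D t ]
  level-suc {t} D t<∣D∣ = trans (cong weight (take-suc-stepAt D t<∣D∣)) (weight-++ (take t D) _)

  Ascent : List Step → ℕ → Set
  Ascent D t = level a b D t ℤ.< level a b D (suc t)

  ascent⇔north : 0 < b → ∀ D → t < length D → Ascent D t ⇔ stepAt D t ≡ N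
  ascent⇔north {t} 0<b D t<∣D∣ rewrite level-suc D t<∣D∣ = by-step (stepAt D t)
    where
    ℓ : ℤ
    ℓ = level a b D t
    by-step : ∀ x → ℓ ℤ.< ℓ ℤ.+ weight [ x ] ⇔ x ≡ N
    by-step N = mk⇔ (λ _ → refl) λ _ → subst (ℤ._< ℓ ℤ.+ weight [ N ]) (ℤ.+-identityʳ ℓ)
      (ℤ.+-monoʳ-< ℓ (subst (0ℤ ℤ.<_) (sym weight-N) (ℤ.+<+ 0<b)))
    by-step E = mk⇔ (λ up → contradiction up (ℤ.≤⇒≯ descent)) λ ()
      where
      descent : ℓ ℤ.+ weight [ E ] ℤ.≤ ℓ
      descent = subst (λ w → ℓ ℤ.+ w ℤ.≤ ℓ) (sym weight-E) (ℤ.i-j≤i ℓ (+ a))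

  level-+ : ∀ w s d → level a b w (s + d) ≡ level a b w s ℤ.+ weight (take d (drop s w))
  level-+ w s d = trans (cong weight (take-+ s d w)) (weight-++ (take s w) _)

  level-rotate-≤ : ∀ w m t → m + t ≤ length w →
                   level a b (rotate m w) t ℤ.+ level a b w m ≡ level a b w (m + t)
  level-rotate-≤ w m t m+t≤n = begin
    weight (take t (drop m w ++ take m w)) ℤ.+ level a b w m
      ≡⟨ cong (λ v → weight v ℤ.+ level a b w m) (take-++ˡ (drop m w) (take m w) t≤) ⟩
    weight (take t (drop m w)) ℤ.+ level a b w m
      ≡⟨ ℤ.+-comm (weight (take t (drop m w))) _ ⟩
    level a b w m ℤ.+ weight (take t (drop m w))
      ≡⟨ level-+ w m t ⟨
    level a b w (m + t) ∎
    where
    open ≡-Reasoning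
    t≤ : t ≤ length (drop m w)
    t≤ = subst (t ≤_) (sym (length-drop m w))
               (ℕ.m+n≤o⇒m≤o∸n t (subst (_≤ length w) (ℕ.+-comm m t) m+t≤n))

  level-rotate-≥ : ∀ w m u → u ≤ m → level a b (rotate m w) (length w ∸ m + u) ℤ.+ level a b w m
                                       ≡ weight w ℤ.+ level a b w u
  level-rotate-≥ w m u u≤m = begin
    weight (take (length w ∸ m + u) (drop m w ++ take m w)) ℤ.+ level a b w m
      ≡⟨ cong (λ v → weight v ℤ.+ level a b w m) prefix ⟩
    weight (drop m w ++ take u w) ℤ.+ level a b w m
      ≡⟨ cong (ℤ._+ level a b w m) (weight-++ (drop m w) (take u w)) ⟩
    (weight (drop m w) ℤ.+ level a b w u) ℤ.+ level a b w m
      ≡⟨ regroup (weight (drop m w)) (level a b w u) (level a b w m) ⟩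
    (level a b w m ℤ.+ weight (drop m w)) ℤ.+ level a b w u
      ≡⟨ cong (ℤ._+ level a b w u) (trans (sym (weight-++ (take m w) (drop m w)))
                                          (cong weight (take++drop≡id m w))) ⟩
    weight w ℤ.+ level a b w u ∎
    where
    open ≡-Reasoning
    regroup : ∀ (d u m : ℤ) → (d ℤ.+ u) ℤ.+ m ≡ (m ℤ.+ d) ℤ.+ u
    regroup = solve-∀
    prefix : take (length w ∸ m + u) (drop m w ++ take m w) ≡ drop m w ++ take u w
    prefix = begin
      take (length w ∸ m + u) (drop m w ++ take m w)
        ≡⟨ cong (λ k → take (k + u) (drop m w ++ take m w)) (sym (length-drop m w)) ⟩
      take (length (drop m w) + u) (drop m w ++ take m w)
        ≡⟨ take-++ʳ u (drop m w) (take m w) ⟩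
      drop m w ++ take u (take m w)
        ≡⟨ cong (drop m w ++_) (trans (take-take u m w) (cong (λ k → take k w) (ℕ.m≤n⇒m⊓n≡m u≤m))) ⟩
      drop m w ++ take u w ∎

  length-dyck : ∀ {D} → IsDyck a b D → length D ≡ a + b
  length-dyck d = length-balanced (dyck⇒balanced d)

  level-start : ∀ D → level a b D 0 ≡ 0ℤ
  level-start D = weight-[]

  level-end : ∀ {D} → IsDyck a b D → level a b D (a + b) ≡ 0ℤ
  level-end {D} d = trans (cong weight (take-all (a + b) D (ℕ.≤-reflexive (length-dyck d))))
                          (weight-balanced (dyck⇒balanced d))

  dyck-positive : ∀ {D t} → IsDyck a b D → 0 < t → t < a + b → 0ℤ ℤ.< level a b D t
  dyck-positive {D} {t} d 0<t t<n = Equivalence.from (0<weight⇔ (take t D)) (IsDyck.above d t 0<t t<n)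

  dyck-above : ∀ {D} → IsDyck a b D → 0 < t → t < a + b → level a b D 0 ℤ.< level a b D t
  dyck-above {t} {D} d 0<t t<n = subst (ℤ._< level a b D t) (sym (level-start D)) (dyck-positive d 0<t t<n)

  dyck-last-descent : ∀ {D} → IsDyck a b D → 0 < t → suc t ≡ a + b → ¬ Ascent D t
  dyck-last-descent {t} {D} d 0<t t+1≡n up =
    ℤ.<-asym up (subst (ℤ._< level a b D t) (sym end) (dyck-positive d 0<t (subst (t <_) t+1≡n (ℕ.n<1+n t))))
    where
    end : level a b D (suc t) ≡ 0ℤ
    end = trans (cong (level a b D) t+1≡n) (level-end d)

-- Lasers and floors

T-does⇔ : ∀ {P : Set} (P? : Dec P) → T (does P?) ⇔ P
T-does⇔ (yes p) = mk⇔ (λ _ → p) (λ _ → _)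
T-does⇔ (no ¬p) = mk⇔ (λ ()) ¬p

allᵇ≡all : ∀ (p : A → Bool) xs → allᵇ p xs ≡ all p xs
allᵇ≡all p []       = refl
allᵇ≡all p (x ∷ xs) = cong (p x ∧_) (allᵇ≡all p xs)

lastWitness : ∀ {P : ℕ → Set} → Decidable P → P 0 → ∀ {i} → 0 < i →
            ∃ λ m → m < i × P m × (∀ {t} → m < t → t < i → ¬ P t)
lastWitness P? P0 {suc zero}    _ = 0 , s≤s z≤n , P0 , λ 0<t t<1 → contradiction t<1 (ℕ.<⇒≱ (s≤s 0<t))
lastWitness {P} P? P0 {suc (suc k)} _ with P? (suc k) | lastWitness P? P0 {suc k} (s≤s z≤n)
... | yes Pk  | _ = suc k , ℕ.≤-refl , Pk , λ k<t t<k+2 → contradiction (ℕ.≤-pred t<k+2) (ℕ.<⇒≱ k<t)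
... | no ¬Pk | m , m<k+1 , Pm , none = m , ℕ.m≤n⇒m≤1+n m<k+1 , Pm , extend
  where
  extend : ∀ {t} → m < t → t < suc (suc k) → ¬ P t
  extend m<t t<k+2 with ℕ.m≤n⇒m<n∨m≡n (ℕ.≤-pred t<k+2)
  ... | inj₁ t<k+1  = none m<t t<k+1
  ... | inj₂ refl   = ¬Pk

∈-interval⇔ : t ∈ interval m i ⇔ (m < t × t ≤ i)
∈-interval⇔ {t} {m} {i} = mk⇔ to from
  where
  to : t ∈ interval m i → m < t × t ≤ i
  to t∈ with k , k< , refl ← ∈-applyUpTo⁻ (λ k → suc m + k) t∈ = s≤s (ℕ.m≤m+n m k) , bound m i k k<
    where
    bound : ∀ m i k → k < i ∸ m → suc m + k ≤ i
    bound zero    i       k k< = k<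
    bound (suc m) (suc i) k k< = s≤s (bound m i k k<)
  from : m < t × t ≤ i → t ∈ interval m i
  from (m<t , t≤i) = subst (_∈ interval m i) (ℕ.m+[n∸m]≡n m<t)
                            (∈-applyUpTo⁺ (λ k → suc m + k) (offset m i t m<t t≤i))
    where
    offset : ∀ m i t → m < t → t ≤ i → t ∸ suc m < i ∸ m
    offset zero    (suc i) (suc t) (s≤s z≤n) (s≤s t≤i) = s≤s (ℕ.≤-trans (ℕ.m∸n≤m t 0) t≤i)
    offset (suc m) (suc i) (suc t) (s≤s m<t) (s≤s t≤i) = offset m i t m<t t≤i

module _ (lv : ℕ → ℤ) where

  highest-sel : ∀ best ms → highest lv best ms ≡ best ⊎ highest lv best ms ∈ ms
  highest-sel best []       = inj₁ refl
  highest-sel best (m ∷ ms) with lv best ℤ.<? lv m | highest-sel m ms | highest-sel best ms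
  ... | yes _ | inj₁ ≡m  | _        = inj₂ (here ≡m)
  ... | yes _ | inj₂ ∈ms | _        = inj₂ (there ∈ms)
  ... | no _  | _        | inj₁ ≡b  = inj₁ ≡b
  ... | no _  | _        | inj₂ ∈ms = inj₂ (there ∈ms)

  highest-max : ∀ best ms → let h = highest lv best ms in
                lv best ℤ.≤ lv h × All (λ m → lv m ℤ.≤ lv h) ms
  highest-max best []       = ℤ.≤-refl , All.[]
  highest-max best (m ∷ ms) with lv best ℤ.<? lv m
  ... | yes b<m with m≤h , ms≤h ← highest-max m ms    = ℤ.≤-trans (ℤ.<⇒≤ b<m) m≤h , m≤h ∷ ms≤h
  ... | no  b≮m with b≤h , ms≤h ← highest-max best ms = b≤h , ℤ.≤-trans (ℤ.≮⇒≥ b≮m) b≤h ∷ ms≤h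

module Floors (a b : ℕ) (D : List Step) where

  private
    lv : ℕ → ℤ
    lv = level a b D

    candidates : ℕ → List ℕ
    candidates i = filterᵇ (λ m → passesBeneathᵇ a b D m i) (upTo i)

  StaysBelow : ℕ → ℕ → Set
  StaysBelow m i = ∀ {t} → m < t → t ≤ i → lv m ℤ.< lv t

  Beneath : ℕ → ℕ → Set
  Beneath i m = m < i × StaysBelow m i

  record IsFloor (i m : ℕ) : Set where
    constructor isFloor
    field
      before : m < i
      lower  : lv m ℤ.< lv i
      clear  : ∀ {t} → m < t → t < i → lv i ℤ.≤ lv t

  OpensBlock : ℕ → Set
  OpensBlock i = ∀ j → 0 < j → j < i → floorOf a b D j ≢ floorOf a b D i

  passesBeneath⇔ : T (passesBeneathᵇ a b D m i) ⇔ StaysBelow m i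
  passesBeneath⇔ {m} {i} = mk⇔ to from
    where
    below? : ℕ → Bool
    below? t = does (lv m ℤ.<? lv t)
    to : T (passesBeneathᵇ a b D m i) → StaysBelow m i
    to passes {t} m<t t≤i = Equivalence.to (T-does⇔ (lv m ℤ.<? lv t))
      (All.lookup (all⁺ below? _ (subst T (allᵇ≡all below? (interval m i)) passes))
                  (Equivalence.from ∈-interval⇔ (m<t , t≤i)))
    from : StaysBelow m i → T (passesBeneathᵇ a b D m i)
    from below = subst T (sym (allᵇ≡all below? (interval m i))) (all⁻ below? (All.tabulate λ {t} t∈ →
      let m<t , t≤i = Equivalence.to ∈-interval⇔ t∈
      in  Equivalence.from (T-does⇔ (lv m ℤ.<? lv t)) (below m<t t≤i)))

  ∈-candidates⇔ : m ∈ candidates i ⇔ Beneath i m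
  ∈-candidates⇔ {m} {i} = mk⇔ to from
    where
    passes? : Decidable (λ m → T (passesBeneathᵇ a b D m i))
    passes? m = T? (passesBeneathᵇ a b D m i)
    to : m ∈ candidates i → Beneath i m
    to m∈ with m∈upTo , passes ← ∈-filter⁻ passes? {xs = upTo i} m∈ =
      ∈-upTo⁻ m∈upTo , Equivalence.to passesBeneath⇔ passes
    from : Beneath i m → m ∈ candidates i
    from (m<i , below) = ∈-filter⁺ passes? (∈-upTo⁺ m<i) (Equivalence.from passesBeneath⇔ below)

  isFloor-unique : ∀ {i m m′} → IsFloor i m → IsFloor i m′ → m ≡ m′
  isFloor-unique {m = m} {m′} (isFloor m<i m-low m-clear) (isFloor m′<i m′-low m′-clear)
    with ℕ.<-cmp m m′
  ... | tri< m<m′ _ _ = contradiction (m-clear m<m′ m′<i) (ℤ.<⇒≱ m′-low)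
  ... | tri≈ _ m≡m′ _ = m≡m′
  ... | tri> _ _ m′<m = contradiction (m′-clear m′<m m<i) (ℤ.<⇒≱ m-low)

  isFloor⇒beneath : ∀ {i m} → IsFloor i m → Beneath i m
  isFloor⇒beneath (isFloor m<i low clear) = m<i , λ m<t t≤i → case ℕ.m≤n⇒m<n∨m≡n t≤i of λ where
    (inj₁ t<i)  → ℤ.<-≤-trans low (clear m<t t<i)
    (inj₂ refl) → low

  isFloor-exists : ∀ {i} → 0 < i → lv 0 ℤ.< lv i → ∃[ m ] IsFloor i m
  isFloor-exists {i} 0<i low with m , m<i , m-low , none ← lastWitness (λ t → lv t ℤ.<? lv i) low 0<i
    = m , isFloor m<i m-low λ m<t t<i → ℤ.≮⇒≥ (none m<t t<i)

  floorOf-isFloor : ∀ {i} → 0 < i → StaysBelow 0 i → IsFloor i (floorOf a b D i)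
  floorOf-isFloor {i} 0<i above with m , m-floor ← isFloor-exists 0<i (above 0<i ℕ.≤-refl)
    = subst (IsFloor i) (sym r≡m) m-floor
    where
    open IsFloor m-floor
    r : ℕ
    r = floorOf a b D i
    r-beneath : Beneath i r
    r-beneath with highest-sel lv 0 (candidates i)
    ... | inj₁ r≡0 = subst (Beneath i) (sym r≡0) (0<i , above)
    ... | inj₂ r∈  = Equivalence.to ∈-candidates⇔ r∈
    m≤r : lv m ℤ.≤ lv r
    m≤r = All.lookup (proj₂ (highest-max lv 0 (candidates i)))
                     (Equivalence.from ∈-candidates⇔ (isFloor⇒beneath m-floor))
    r≡m : r ≡ m
    r≡m with (r<i , r-below) ← r-beneath | ℕ.<-cmp r m
    ... | tri< r<m _ _ = contradiction m≤r (ℤ.<⇒≱ (r-below r<m (ℕ.<⇒≤ before)))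
    ... | tri≈ _ r≡m _ = r≡m
    ... | tri> _ _ m<r = contradiction (clear m<r r<i) (ℤ.<⇒≱ (r-below r<i ℕ.≤-refl))

  module _ {n} (above : ∀ {t} → 0 < t → t < n → lv 0 ℤ.< lv t) where

    floorOf-isFloor′ : ∀ {i} → 0 < i → i < n → IsFloor i (floorOf a b D i)
    floorOf-isFloor′ 0<i i<n = floorOf-isFloor 0<i λ 0<t t≤i → above 0<t (ℕ.≤-<-trans t≤i i<n)

    floorOf-noncrossing : ∀ {p q r s} → 0 < p → p < q → q < r → r < s → s < n →
      floorOf a b D p ≡ floorOf a b D r → floorOf a b D q ≡ floorOf a b D s →
      floorOf a b D p ≡ floorOf a b D q
    floorOf-noncrossing {p} {q} {r} {s} 0<p p<q q<r r<s s<n fp≡fr fq≡fs = by-cases (ℕ.<-cmp fr fq)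
      where
      open ℤ.≤-Reasoning
      fr fq : ℕ
      fr = floorOf a b D r
      fq = floorOf a b D q
      q<n : q < n
      q<n = ℕ.<-trans q<r (ℕ.<-trans r<s s<n)
      module Fp = IsFloor (floorOf-isFloor′ 0<p (ℕ.<-trans p<q q<n))
      module Fq = IsFloor (floorOf-isFloor′ (ℕ.<-trans 0<p p<q) q<n)
      module Fr = IsFloor (floorOf-isFloor′ (ℕ.<-trans 0<p (ℕ.<-trans p<q q<r)) (ℕ.<-trans r<s s<n))
      module Fs = IsFloor (subst (IsFloor s) (sym fq≡fs)
        (floorOf-isFloor′ (ℕ.<-trans 0<p (ℕ.<-trans p<q (ℕ.<-trans q<r r<s))) s<n))
      fq<r : fq < r
      fq<r = ℕ.<-trans Fq.before q<r
      fr<q : fr < q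
      fr<q = ℕ.<-trans (subst (_< p) fp≡fr Fp.before) p<q
      by-cases : Tri _ _ _ → floorOf a b D p ≡ fq
      by-cases (tri≈ _ fr≡fq _) = trans fp≡fr fr≡fq
      by-cases (tri< fr<fq _ _) = contradiction (begin-strict
        lv r   ≤⟨ Fr.clear fr<fq fq<r ⟩
        lv fq  <⟨ Fs.lower ⟩
        lv s   ≤⟨ Fs.clear fq<r r<s ⟩
        lv r   ∎) (ℤ.<-irrefl refl)
      by-cases (tri> _ _ fq<fr) = contradiction (begin-strict
        lv q   ≤⟨ Fq.clear fq<fr fr<q ⟩
        lv fr  <⟨ Fr.lower ⟩
        lv r   ≤⟨ Fr.clear fr<q q<r ⟩
        lv q   ∎) (ℤ.<-irrefl refl)

    floorOf-after-ascent : suc k < n → lv k ℤ.< lv (suc k) → floorOf a b D (suc k) ≡ k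
    floorOf-after-ascent {k} k+1<n up = isFloor-unique (floorOf-isFloor′ (s≤s z≤n) k+1<n)
      (isFloor (ℕ.n<1+n k) up λ k<t t<k+1 → contradiction (ℕ.≤-pred t<k+1) (ℕ.<⇒≱ k<t))

    ascent⇒opensBlock : suc k < n → lv k ℤ.< lv (suc k) → OpensBlock (suc k)
    ascent⇒opensBlock {k} k+1<n up j 0<j j<k+1 fj≡fk+1 =
      ℕ.<-irrefl (trans fj≡fk+1 (floorOf-after-ascent k+1<n up)) (ℕ.<-≤-trans fj<j (ℕ.≤-pred j<k+1))
      where
      fj<j : floorOf a b D j < j
      fj<j = IsFloor.before (floorOf-isFloor′ 0<j (ℕ.<-trans j<k+1 k+1<n))

    descent⇒¬opensBlock : suc k < n → ¬ lv k ℤ.< lv (suc k) → ¬ OpensBlock (suc k)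
    descent⇒¬opensBlock {k} k+1<n ¬up opens =
      opens (suc f) (s≤s z≤n) (s≤s f<k) (floorOf-after-ascent f+1<n f-up)
      where
      open IsFloor (floorOf-isFloor′ (s≤s z≤n) k+1<n)
      f : ℕ
      f = floorOf a b D (suc k)
      f<k : f < k
      f<k = ℕ.≤∧≢⇒< (ℕ.≤-pred before) λ f≡k → ¬up (subst (λ x → lv x ℤ.< lv (suc k)) f≡k lower)
      f+1<n : suc f < n
      f+1<n = ℕ.<-trans (s≤s f<k) k+1<n
      f-up : lv f ℤ.< lv (suc f)
      f-up = ℤ.<-≤-trans lower (clear (ℕ.n<1+n f) (s≤s f<k))

    opensBlock⇔ascent : suc k < n → OpensBlock (suc k) ⇔ lv k ℤ.< lv (suc k)
    opensBlock⇔ascent {k} k+1<n with lv k ℤ.<? lv (suc k)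
    ... | yes up = mk⇔ (λ _ → up) (λ _ → ascent⇒opensBlock k+1<n up)
    ... | no ¬up = mk⇔ (λ opens → contradiction opens (descent⇒¬opensBlock k+1<n ¬up))
                       (λ up → contradiction up ¬up)

-- The partition μ(D)

module Partitions (a b : ℕ) where

  open Levels a b

  μ-sameBlock⇔ : ∀ D (x y : Fin (a + b ∸ 1)) →
    SameBlock (μ a b D) x y ⇔ floorOf a b D (suc (toℕ x)) ≡ floorOf a b D (suc (toℕ y))
  μ-sameBlock⇔ D x y = mk⇔
    (λ same → ℕ.≡ᵇ⇒≡ fx fy (Equivalence.from T-≡ (trans (sym entry) same)))
    (λ same → trans entry (Equivalence.to T-≡ (ℕ.≡⇒≡ᵇ fx fy same)))
    where
    fx fy : ℕ
    fx = floorOf a b D (suc (toℕ x))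
    fy = floorOf a b D (suc (toℕ y))
    entry : lookup (lookup (μ a b D) x) y ≡ (fx ≡ᵇ fy)
    entry = trans (cong (λ row → lookup row y) (lookup∘tabulate _ x)) (lookup∘tabulate _ y)

  μ-sameFloor : ∀ {D D′ x y} → μ a b D ≡ μ a b D′ → suc x < a + b → suc y < a + b →
    floorOf a b D (suc x) ≡ floorOf a b D (suc y) → floorOf a b D′ (suc x) ≡ floorOf a b D′ (suc y)
  μ-sameFloor {D} {D′} {x} {y} μ≡ x+1<n y+1<n same =
    subst₂ (sameFloor D′) (toℕ-fromℕ< x<) (toℕ-fromℕ< y<)
      (Equivalence.to (μ-sameBlock⇔ D′ x′ y′) (subst (λ M → SameBlock M x′ y′) μ≡
        (Equivalence.from (μ-sameBlock⇔ D x′ y′)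
          (subst₂ (sameFloor D) (sym (toℕ-fromℕ< x<)) (sym (toℕ-fromℕ< y<)) same))))
    where
    sameFloor : List Step → ℕ → ℕ → Set
    sameFloor D x y = floorOf a b D (suc x) ≡ floorOf a b D (suc y)
    x< : x < a + b ∸ 1
    x< = suc<⇒<∸1 x+1<n
    y< : y < a + b ∸ 1
    y< = suc<⇒<∸1 y+1<n
    x′ y′ : Fin (a + b ∸ 1)
    x′ = fromℕ< x<
    y′ = fromℕ< y<

  μ-noncrossing : ∀ {D} → IsDyck a b D → NonCrossing (μ a b D)
  μ-noncrossing {D} d p q r s p<q q<r r<s p~r q~s = Equivalence.from (μ-sameBlock⇔ D p q)
    (floorOf-noncrossing (dyck-above d) (s≤s z≤n) (s≤s p<q) (s≤s q<r) (s≤s r<s) (<∸1⇒suc< (toℕ<n s))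
      (Equivalence.to (μ-sameBlock⇔ D p r) p~r) (Equivalence.to (μ-sameBlock⇔ D q s) q~s))
    where open Floors a b D

  μ-opensBlock : ∀ {D D′} → μ a b D ≡ μ a b D′ → suc k < a + b →
                 Floors.OpensBlock a b D (suc k) → Floors.OpensBlock a b D′ (suc k)
  μ-opensBlock μ≡ k+1<n opens (suc j) 0<j j<k+1 same =
    opens (suc j) 0<j j<k+1 (μ-sameFloor (sym μ≡) (ℕ.<-trans j<k+1 k+1<n) k+1<n same)

  μ-injective : 0 < a → 0 < b → ∀ {D D′} → IsDyck a b D → IsDyck a b D′ →
                μ a b D ≡ μ a b D′ → D ≡ D′
  μ-injective 0<a 0<b {D} {D′} d d′ μ≡ =
    stepAt-extensionality D D′ (trans (length-dyck d) (sym (length-dyck d′)))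
      λ t<∣D∣ → same-step (subst (_ <_) (length-dyck d) t<∣D∣)
    where
    same-ascent : t < a + b → Ascent D t ⇔ Ascent D′ t
    same-ascent {t} t<n with ℕ.m≤n⇒m<n∨m≡n t<n
    ... | inj₁ t+1<n = ⇔.trans (⇔.sym (Floors.opensBlock⇔ascent a b D (dyck-above d) t+1<n))
                      (⇔.trans (mk⇔ (μ-opensBlock μ≡ t+1<n) (μ-opensBlock (sym μ≡) t+1<n))
                               (Floors.opensBlock⇔ascent a b D′ (dyck-above d′) t+1<n))
    ... | inj₂ t+1≡n = mk⇔ (λ up → contradiction up (dyck-last-descent d 0<t t+1≡n))
                          (λ up → contradiction up (dyck-last-descent d′ 0<t t+1≡n))
      where
      0<t : 0 < t
      0<t = ℕ.≤-pred (subst (2 ≤_) (sym t+1≡n) (ℕ.+-mono-≤ 0<a 0<b))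
    same-step : t < a + b → stepAt D t ≡ stepAt D′ t
    same-step {t} t<n = ≡N⇔≡N⇒≡ (⇔.trans (⇔.sym (ascent⇔north 0<b D (t<length d)))
                                 (⇔.trans (same-ascent t<n) (ascent⇔north 0<b D′ (t<length d′))))
      where
      t<length : ∀ {P} → IsDyck a b P → t < length P
      t<length p = subst (t <_) (sym (length-dyck p)) t<n

-- The cycle lemma

module Cycles (a b : ℕ) where

  open Levels a b

  lowest : List Step → ℕ
  lowest w = argmin (level a b w) 0 (upTo (length w))

  lowest≤length : ∀ w → lowest w ≤ length w
  lowest≤length w = argmin-all (level a b w) {P = _≤ length w} z≤n (All.tabulate (ℕ.<⇒≤ ∘ ∈-upTo⁻))

  lowest<length : ∀ w → 0 < length w → lowest w < length w
  lowest<length w 0<n = argmin-all (level a b w) {P = _< length w} 0<n (All.tabulate ∈-upTo⁻)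

  lowest-minimal : ∀ w → t < length w → level a b w (lowest w) ℤ.≤ level a b w t
  lowest-minimal w t<n = All.lookup (f[argmin]≤f[xs] {f = level a b w} 0 (upTo (length w))) (∈-upTo⁺ t<n)

  decompose : List Step → List Step × ℕ
  decompose w = rotate (lowest w) w , unrotation (length w) (lowest w)

  recompose : List Step × ℕ → List Step
  recompose (D , k) = rotate k D

  recompose∘decompose : ∀ w → recompose (decompose w) ≡ w
  recompose∘decompose w = rotate-unrotate (lowest w) w (lowest≤length w)

  decompose-injective : ∀ {w w′} → decompose w ≡ decompose w′ → w ≡ w′
  decompose-injective {w} {w′} same =
    trans (sym (recompose∘decompose w)) (trans (cong recompose same) (recompose∘decompose w′))

  module _ (0<a : 0 < a) (0<b : 0 < b) (cop : Coprime a b) where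

    0<n : 0 < a + b
    0<n = ℕ.<-≤-trans 0<a (ℕ.m≤m+n a b)

    lowest<n : ∀ {w} → Balanced a b w → lowest w < a + b
    lowest<n {w} bal = subst (lowest w <_) ∣w∣≡n (lowest<length w (subst (0 <_) (sym ∣w∣≡n) 0<n))
      where
      ∣w∣≡n : length w ≡ a + b
      ∣w∣≡n = length-balanced bal

    level-injective : ∀ {w s t} → Balanced a b w → s < t → t < a + b → level a b w s ≢ level a b w t
    level-injective {w} {s} {t} bal s<t t<n ls≡lt = ℕ.<⇒≱ d<n (subst (a + b ≤_) ∣v∣≡d long)
      where
      d : ℕ
      d = t ∸ s
      v : List Step
      v = take d (drop s w)
      d<n : d < a + b
      d<n = ℕ.≤-<-trans (ℕ.m∸n≤m t s) t<n
      flat : weight v ≡ 0ℤ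
      flat = identityʳ-unique (level a b w s) (weight v) (begin
        level a b w s ℤ.+ weight v  ≡⟨ level-+ w s d ⟨
        level a b w (s + d)         ≡⟨ cong (level a b w) (ℕ.m+[n∸m]≡n (ℕ.<⇒≤ s<t)) ⟩
        level a b w t               ≡⟨ ls≡lt ⟨
        level a b w s               ∎)
        where open ≡-Reasoning
      d≤∣drop∣ : d ≤ length (drop s w)
      d≤∣drop∣ = subst (d ≤_) (sym (trans (length-drop s w) (cong (_∸ s) (length-balanced bal))))
                       (ℕ.∸-monoˡ-≤ s (ℕ.<⇒≤ t<n))
      ∣v∣≡d : length v ≡ d
      ∣v∣≡d = trans (length-take d (drop s w)) (ℕ.m≤n⇒m⊓n≡m d≤∣drop∣)
      long : a + b ≤ length v
      long = subst (a + b ≤_) (sym (length≡northCount+eastCount v))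
        (coprime-lattice-bound 0<a 0<b cop (weight≡0⇒ v flat)
          (subst (0 <_) (trans (sym ∣v∣≡d) (length≡northCount+eastCount v)) (ℕ.m<n⇒0<n∸m s<t)))

    lowest-strict : ∀ {w t} → Balanced a b w → t < a + b → t ≢ lowest w →
                    level a b w (lowest w) ℤ.< level a b w t
    lowest-strict {w} {t} bal t<n t≢m =
      ℤ.≤∧≢⇒< (lowest-minimal w (subst (t <_) (sym (length-balanced bal)) t<n)) distinct
      where
      distinct : level a b w (lowest w) ≢ level a b w t
      distinct with ℕ.<-cmp t (lowest w)
      ... | tri< t<m _ _ = level-injective bal t<m (lowest<n bal) ∘ sym
      ... | tri≈ _ t≡m _ = contradiction t≡m t≢m
      ... | tri> _ _ m<t = level-injective bal m<t t<n

    rotate-lowest-positive : ∀ {w t} → Balanced a b w → 0 < t → t < a + b →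
                             0ℤ ℤ.< level a b (rotate (lowest w) w) t
    rotate-lowest-positive {w} {t} bal 0<t t<n with lowest w + t ℕ.<? a + b
    ... | yes low+t<n = i+j≡k∧j<k⇒0<i
      (level-rotate-≤ w low t (subst (low + t ≤_) (sym ∣w∣≡n) (ℕ.<⇒≤ low+t<n)))
      (lowest-strict bal low+t<n (ℕ.<⇒≢ (ℕ.m<m+n low 0<t) ∘ sym))
      where
      low : ℕ
      low = lowest w
      ∣w∣≡n : length w ≡ a + b
      ∣w∣≡n = length-balanced bal
    ... | no  low+t≮n =
      i+j≡k∧j<k⇒0<i wrapped (lowest-strict bal (ℕ.<-trans r<low (lowest<n bal)) (ℕ.<⇒≢ r<low))
      where
      low r : ℕ
      low = lowest w
      r = low + t ∸ (a + b)
      ∣w∣≡n : length w ≡ a + b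
      ∣w∣≡n = length-balanced bal
      n≤low+t : a + b ≤ low + t
      n≤low+t = ℕ.≮⇒≥ low+t≮n
      r<low : r < low
      r<low = subst (r <_) (ℕ.m+n∸m≡n (a + b) low)
        (ℕ.∸-monoˡ-< (subst (low + t <_) (ℕ.+-comm low (a + b)) (ℕ.+-monoʳ-< low t<n)) n≤low+t)
      t≡ : length w ∸ low + r ≡ t
      t≡ = trans (cong (λ k → k ∸ low + r) ∣w∣≡n)
                 (wrap-offset (subst (low ≤_) ∣w∣≡n (lowest≤length w)) n≤low+t)
      wrapped : level a b (rotate low w) t ℤ.+ level a b w low ≡ level a b w r
      wrapped = subst (λ k → level a b (rotate low w) k ℤ.+ level a b w low ≡ level a b w r) t≡
        (trans (level-rotate-≥ w low r (ℕ.<⇒≤ r<low))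
               (trans (cong (ℤ._+ level a b w r) (weight-balanced bal)) (ℤ.+-identityˡ _)))

    rotate-lowest-isDyck : ∀ {w} → Balanced a b w → IsDyck a b (rotate (lowest w) w)
    rotate-lowest-isDyck {w} bal = record
      { north-steps = Balanced.north-steps rotated
      ; east-steps  = Balanced.east-steps rotated
      ; above       = λ t 0<t t<n →
          Equivalence.to (0<weight⇔ (take t (rotate (lowest w) w))) (rotate-lowest-positive bal 0<t t<n)
      }
      where
      rotated : Balanced a b (rotate (lowest w) w)
      rotated = rotate-balanced (lowest w) bal

    rotate-dyck-trivial : ∀ {D s} → IsDyck a b D → s < a + b → IsDyck a b (rotate s D) → s ≡ 0
    rotate-dyck-trivial {D} {zero}  _ _     _  = refl
    rotate-dyck-trivial {D} {suc s} d s<n d′ =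
      contradiction (sym sum≡0) (ℤ.<⇒≢ (ℤ.+-mono-< after-rotation before-rotation))
      where
      n : ℕ
      n = a + b
      s+[n∸s]≡n : suc s + (n ∸ suc s) ≡ n
      s+[n∸s]≡n = ℕ.m+[n∸m]≡n (ℕ.<⇒≤ s<n)
      sum≡0 : level a b (rotate (suc s) D) (n ∸ suc s) ℤ.+ level a b D (suc s) ≡ 0ℤ
      sum≡0 = trans
        (level-rotate-≤ D (suc s) (n ∸ suc s) (ℕ.≤-reflexive (trans s+[n∸s]≡n (sym (length-dyck d)))))
        (trans (cong (level a b D) s+[n∸s]≡n) (level-end d))
      after-rotation : 0ℤ ℤ.< level a b (rotate (suc s) D) (n ∸ suc s)
      after-rotation = dyck-positive d′ (ℕ.m<n⇒0<n∸m s<n) (ℕ.∸-monoʳ-< (s≤s z≤n) (ℕ.<⇒≤ s<n))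
      before-rotation : 0ℤ ℤ.< level a b D (suc s)
      before-rotation = dyck-positive d (s≤s z≤n) s<n

    decompose-rotate : ∀ {D k} → IsDyck a b D → k < a + b → decompose (rotate k D) ≡ (D , k)
    decompose-rotate {D} {k} d k<n =
      from-cyclic (rotate-rotate-cyclic (lowest w) k D (subst (lowest w <_) (sym ∣D∣≡n) low<n) k<∣D∣)
      where
      w : List Step
      w = rotate k D
      ∣D∣≡n : length D ≡ a + b
      ∣D∣≡n = length-dyck d
      ∣w∣≡∣D∣ : length w ≡ length D
      ∣w∣≡∣D∣ = length-rotate k D
      k<∣D∣ : k < length D
      k<∣D∣ = subst (k <_) (sym ∣D∣≡n) k<n
      low<n : lowest w < a + b
      low<n = lowest<n (rotate-balanced k (dyck⇒balanced d))
      from-cyclic : ∃[ s ] s < length D × rotate (lowest w) w ≡ rotate s D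
                          × (lowest w + k ≡ s ⊎ lowest w + k ≡ length D + s) →
                    decompose w ≡ (D , k)
      from-cyclic (s , s<∣D∣ , rotations , sum) = cong₂ _,_
        (trans rotations (trans (cong (λ s → rotate s D) s≡0) (rotate-zero D)))
        (unrotation-complement (subst (k <_) (sym ∣w∣≡∣D∣) k<∣D∣)
          (Sum.map (λ eq → trans eq s≡0) (λ eq → trans eq (cong₂ _+_ (sym ∣w∣≡∣D∣) s≡0)) sum))
        where
        s≡0 : s ≡ 0
        s≡0 = rotate-dyck-trivial d (subst (s <_) ∣D∣≡n s<∣D∣)
                (subst (IsDyck a b) rotations (rotate-lowest-isDyck (rotate-balanced k (dyck⇒balanced d))))

    length-paths≡ : length (paths a b) ≡ length (dyckPaths a b) * (a + b)
    length-paths≡ = begin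
      length (paths a b)
        ≡⟨ length-map decompose (paths a b) ⟨
      length (map decompose (paths a b))
        ≡⟨ ℕ.≤-antisym (Unique⇒length≤ decompositions-unique decomposition⊆) (Unique⇒length≤ pairs-unique pair⊆) ⟩
      length pairs
        ≡⟨ length-cartesianProduct (dyckPaths a b) (upTo (a + b)) ⟩
      length (dyckPaths a b) * length (upTo (a + b))
        ≡⟨ cong (length (dyckPaths a b) *_) (length-upTo (a + b)) ⟩
      length (dyckPaths a b) * (a + b) ∎
      where
      open ≡-Reasoning
      pairs : List (List Step × ℕ)
      pairs = cartesianProduct (dyckPaths a b) (upTo (a + b))
      decompositions-unique : Unique (map decompose (paths a b))
      decompositions-unique = Unique.map⁺ decompose-injective (paths-unique a b)
      pairs-unique : Unique pairs
      pairs-unique = Unique.cartesianProduct⁺ (dyckPaths-unique a b) (Unique.upTo⁺ (a + b))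
      decomposition⊆ : map decompose (paths a b) ⊆ pairs
      decomposition⊆ x∈ with w , w∈ , refl ← ∈-map⁻ decompose x∈ = ∈-cartesianProduct⁺
        (Equivalence.from ∈-dyckPaths⇔ (rotate-lowest-isDyck bal))
        (∈-upTo⁺ (subst (λ n → unrotation n (lowest w) < a + b) (sym (length-balanced bal))
                        (unrotation< (lowest<n bal))))
        where
        bal : Balanced a b w
        bal = Equivalence.to ∈-paths⇔ w∈
      pair⊆ : pairs ⊆ map decompose (paths a b)
      pair⊆ {D , k} x∈ with D∈ , k∈ ← ∈-cartesianProduct⁻ (dyckPaths a b) (upTo (a + b)) x∈ =
        subst (_∈ map decompose (paths a b)) (decompose-rotate d (∈-upTo⁻ k∈))
          (∈-map⁺ decompose (Equivalence.from ∈-paths⇔ (rotate-balanced k (dyck⇒balanced d))))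
        where
        d : IsDyck a b D
        d = Equivalence.to ∈-dyckPaths⇔ D∈

    length-dyckPaths : length (dyckPaths a b) * (a ! * b !) ≡ (a + b ∸ 1) !
    length-dyckPaths = m*n*o≡n!⇒m*o≡[n∸1]! (length (dyckPaths a b)) (a + b) (a ! * b !) 0<n
      (trans (cong (_* (a ! * b !)) (sym length-paths≡)) (length-paths a b))

proposition5p1 : (a b : ℕ) → 0 < a → a < b → Coprime a b →
    ((D : List Step) → IsDyck a b D → NonCrossing (μ a b D))
    × ((D D′ : List Step) → IsDyck a b D → IsDyck a b D′ → μ a b D ≡ μ a b D′ → D ≡ D′)
    × Σ (List (Partition (a + b ∸ 1)))
        (λ L → Unique L
             × ((M : Partition (a + b ∸ 1)) → (M ∈ L) ⇔ HomogeneousNC a b M)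
             × length L ≡ ((a + b ∸ 1) ! / (a ! * b !)) {{a !* b !≢0}})
proposition5p1 a b 0<a a<b cop =
    (λ D → μ-noncrossing)
  , (λ D D′ → μ-injective 0<a 0<b)
  , map (μ a b) (dyckPaths a b)
  , Unique-map⁺ (μ a b) (λ D∈ D′∈ → μ-injective 0<a 0<b (dyck D∈) (dyck D′∈)) (dyckPaths-unique a b)
  , (λ M → mk⇔ ∈⇒homogeneous homogeneous⇒∈)
  , (begin
      length (map (μ a b) (dyckPaths a b))               ≡⟨ length-map (μ a b) (dyckPaths a b) ⟩
      length (dyckPaths a b)                             ≡⟨ m*n/n≡m (length (dyckPaths a b)) (a ! * b !) ⟨
      length (dyckPaths a b) * (a ! * b !) / (a ! * b !) ≡⟨ cong (_/ (a ! * b !)) (length-dyckPaths 0<a 0<b cop) ⟩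
      (a + b ∸ 1) ! / (a ! * b !)                        ∎)
  where
  open ≡-Reasoning
  open Partitions a b
  open Cycles a b
  instance
    a!b!≢0 : NonZero (a ! * b !)
    a!b!≢0 = a !* b !≢0
  0<b : 0 < b
  0<b = ℕ.<-trans 0<a a<b
  dyck : ∀ {D} → D ∈ dyckPaths a b → IsDyck a b D
  dyck = Equivalence.to ∈-dyckPaths⇔
  ∈⇒homogeneous : ∀ {M} → M ∈ map (μ a b) (dyckPaths a b) → HomogeneousNC a b M
  ∈⇒homogeneous M∈ with D , D∈ , M≡μD ← ∈-map⁻ (μ a b) M∈ = D , dyck D∈ , sym M≡μD
  homogeneous⇒∈ : ∀ {M} → HomogeneousNC a b M → M ∈ map (μ a b) (dyckPaths a b)
  homogeneous⇒∈ (D , d , μD≡M) = subst (_∈ map (μ a b) (dyckPaths a b)) μD≡M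
                                       (∈-map⁺ (μ a b) (Equivalence.from ∈-dyckPaths⇔ d))
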